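{- For every finite simple graph $G$, $\chi(G)\le\frac{\iota(G)+|G|}{2}$.
   Context: $|G|$ is the number of vertices of $G$. The stinginess $\iota(G)$ is the maximum number of singleton color classes appearing in an optimal (i.e. $\chi(G)$-color) proper coloring of $G$. -}

module Defs where

open import Data.Nat using (ℕ; _≤_)
import Data.Nat
open import Data.Fin using (Fin)
open import Data.Fin.Properties using (_≟_)
open import Data.Product using (Σ; _×_; _,_)
open import Data.Empty using (⊥)
open import Data.List using (List; filter; length)
open import Data.List using () renaming (allFin to allFinL)
open import Relation.Nullary using (¬_)
open import Relation.Nullary.Decidable using (⌊_⌋)
open import Relation.Binary.PropositionalEquality using (_≡_)
open import Level using (0ℓ; suc)

record Graph (n : ℕ) : Set₁ where
  field
    Adj   : Fin n → Fin n → Set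
    sym   : ∀ {u v} → Adj u v → Adj v u
    irrefl : ∀ {v} → ¬ Adj v v
open Graph public

Proper : ∀ {n} (G : Graph n) (k : ℕ) → (Fin n → Fin k) → Set
Proper G k c = ∀ u v → Adj G u v → ¬ (c u ≡ c v)

Colorable : ∀ {n} (G : Graph n) (k : ℕ) → Set
Colorable {n} G k = Σ (Fin n → Fin k) (Proper G k)

IsChromaticNumber : ∀ {n} (G : Graph n) (k : ℕ) → Set
IsChromaticNumber G k = Colorable G k × (∀ m → Colorable G m → k ≤ m)

classSize : ∀ {n k} → (Fin n → Fin k) → Fin k → ℕ
classSize {n} c j = length (filter (λ v → c v ≟ j) (allFinL n))

singletons : ∀ {n k} → (Fin n → Fin k) → ℕ
singletons {n} {k} c = length (filter (λ j → classSize c j Data.Nat.≟ 1) (allFinL k))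

IsStinginess : ∀ {n} (G : Graph n) (s : ℕ) → Set
IsStinginess {n} G s = Σ ℕ λ χ → IsChromaticNumber G χ ×
  (Σ (Fin n → Fin χ) (λ c → Proper G χ c × singletons c ≡ s)) ×
  (∀ (c : Fin n → Fin χ) → Proper G χ c → singletons c ≤ s)

-- Take an optimal colouring c with χ colours. Every colour class is nonempty, since otherwise
-- the colour could be dropped. A nonempty class of size s satisfies 2 ≤ s + [s = 1], and
-- summing over the χ classes gives 2χ ≤ n + (number of singleton classes of c) ≤ n + ι.
module Submission where

open import Defs hiding (sym)
open import Data.Nat using (ℕ; zero; suc; z≤n; s≤s; _≤_; _<_; _+_; _*_)
import Data.Nat as ℕ
open import Data.Nat.Properties
  using (+-comm; +-monoʳ-≤; +-mono-≤; *-suc; ≤-refl; ≤-antisym; n≢0⇒n>0; 1+n≰n;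
         +-commutativeSemigroup; module ≤-Reasoning)
open import Data.Nat.ListAction using (sum)
open import Algebra.Properties.CommutativeSemigroup +-commutativeSemigroup using (interchange)
open import Data.Bool using (if_then_else_)
open import Data.Fin using (Fin; punchOut) renaming (zero to fzero; suc to fsuc)
open import Data.Fin.Properties using (_≟_; punchOut-injective)
open import Data.List using (List; []; _∷_; filter; length; map; tabulate; allFin)
open import Data.List.Properties using (map-tabulate; tabulate-cong; length-tabulate; filter-some)
open import Data.List.Membership.Propositional.Properties using (∈-allFin)
import Data.List.Relation.Unary.Any as Any
open import Data.Product using (_,_)
open import Relation.Nullary using (does; yes; no)
open import Relation.Binary.Definitions using (DecidableEquality)
open import Relation.Binary.PropositionalEquality

module _ {B : Set} (_≟_ : DecidableEquality B) where

  δ : B → B → ℕ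
  δ x y = if does (x ≟ y) then 1 else 0

  -- classSize c j and singletons c are, definitionally, fibreSize counts
  -- (of c over allFin n, resp. of classSize c over allFin k).
  module _ {A : Set} (f : A → B) where

    fibreSize : List A → B → ℕ
    fibreSize xs y = length (filter (λ x → f x ≟ y) xs)

    fibreSize-∷ : ∀ x xs y → fibreSize (x ∷ xs) y ≡ δ (f x) y + fibreSize xs y
    fibreSize-∷ x xs y with f x ≟ y
    ... | yes _ = refl
    ... | no _ = refl

sum-tabulate-zero : ∀ k → sum (tabulate {n = k} (λ _ → 0)) ≡ 0
sum-tabulate-zero zero = refl
sum-tabulate-zero (suc k) = sum-tabulate-zero k

sum-tabulate-+ : ∀ {k} (g h : Fin k → ℕ) →
  sum (tabulate (λ j → g j + h j)) ≡ sum (tabulate g) + sum (tabulate h)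
sum-tabulate-+ {zero} g h = refl
sum-tabulate-+ {suc k} g h = begin
  g fzero + h fzero + sum (tabulate (λ j → g (fsuc j) + h (fsuc j)))
    ≡⟨ cong (g fzero + h fzero +_) (sum-tabulate-+ (λ j → g (fsuc j)) (λ j → h (fsuc j))) ⟩
  g fzero + h fzero + (sum (tabulate (λ j → g (fsuc j))) + sum (tabulate (λ j → h (fsuc j))))
    ≡⟨ interchange (g fzero) (h fzero) _ _ ⟩
  sum (tabulate g) + sum (tabulate h) ∎
  where open ≡-Reasoning

sum-δ : ∀ {k} (i : Fin k) → sum (tabulate (δ _≟_ i)) ≡ 1
sum-δ {suc k} fzero = cong suc (sum-tabulate-zero k)
sum-δ {suc k} (fsuc i) = sum-δ i

sum-fibreSize : ∀ {A : Set} {k} (f : A → Fin k) xs → sum (tabulate (fibreSize _≟_ f xs)) ≡ length xs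
sum-fibreSize {k = k} f [] = sum-tabulate-zero k
sum-fibreSize f (x ∷ xs) = begin
  sum (tabulate (fibreSize _≟_ f (x ∷ xs)))
    ≡⟨ cong sum (tabulate-cong (fibreSize-∷ _≟_ f x xs)) ⟩
  sum (tabulate (λ j → δ _≟_ (f x) j + fibreSize _≟_ f xs j))
    ≡⟨ sum-tabulate-+ (δ _≟_ (f x)) (fibreSize _≟_ f xs) ⟩
  sum (tabulate (δ _≟_ (f x))) + sum (tabulate (fibreSize _≟_ f xs))
    ≡⟨ cong₂ _+_ (sum-δ (f x)) (sum-fibreSize f xs) ⟩
  suc (length xs) ∎
  where open ≡-Reasoning

sum-classSize : ∀ {n k} (c : Fin n → Fin k) → sum (map (classSize c) (allFin k)) ≡ n
sum-classSize {n} {k} c = begin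
  sum (map (classSize c) (allFin k)) ≡⟨ cong sum (map-tabulate (λ j → j) (classSize c)) ⟩
  sum (tabulate (classSize c))       ≡⟨ sum-fibreSize c (allFin n) ⟩
  length (allFin n)                  ≡⟨ length-tabulate (λ v → v) ⟩
  n ∎
  where open ≡-Reasoning

2≤n+δn1 : ∀ {n} → 0 < n → 2 ≤ n + δ ℕ._≟_ n 1
2≤n+δn1 {1} _ = ≤-refl
2≤n+δn1 {suc (suc n)} _ = s≤s (s≤s z≤n)

2*length≤sum+ones : ∀ {B : Set} (g : B → ℕ) → (∀ b → 0 < g b) →
  ∀ bs → 2 * length bs ≤ sum (map g bs) + fibreSize ℕ._≟_ g bs 1
2*length≤sum+ones g g-pos [] = z≤n
2*length≤sum+ones g g-pos (b ∷ bs) = begin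
  2 * suc (length bs)
    ≡⟨ *-suc 2 (length bs) ⟩
  2 + 2 * length bs
    ≤⟨ +-mono-≤ (2≤n+δn1 (g-pos b)) (2*length≤sum+ones g g-pos bs) ⟩
  g b + δ ℕ._≟_ (g b) 1 + (sum (map g bs) + fibreSize ℕ._≟_ g bs 1)
    ≡⟨ interchange (g b) _ _ _ ⟩
  g b + sum (map g bs) + (δ ℕ._≟_ (g b) 1 + fibreSize ℕ._≟_ g bs 1)
    ≡⟨ cong (g b + sum (map g bs) +_) (sym (fibreSize-∷ ℕ._≟_ g b bs 1)) ⟩
  sum (map g (b ∷ bs)) + fibreSize ℕ._≟_ g (b ∷ bs) 1 ∎
  where open ≤-Reasoning

module _ {n : ℕ} (G : Graph n) where

  drop-unused-color : ∀ {k} (c : Fin n → Fin (suc k)) j → (∀ v → c v ≢ j) →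
    Proper G (suc k) c → Colorable G k
  drop-unused-color c j unused proper = c′ , λ u v u~v c′u≡c′v →
    proper u v u~v (punchOut-injective (j≢c u) (j≢c v) c′u≡c′v)
    where
    j≢c : ∀ v → j ≢ c v
    j≢c v = ≢-sym (unused v)
    c′ : Fin n → Fin _
    c′ v = punchOut (j≢c v)

  classSize-pos : ∀ {k} (c : Fin n → Fin k) → Proper G k c → (∀ m → Colorable G m → k ≤ m) →
    ∀ j → 0 < classSize c j
  classSize-pos {suc k} c proper minimal j = n≢0⇒n>0 λ size≡0 →
    1+n≰n (minimal k (drop-unused-color c j (unused size≡0) proper))
    where
    unused : classSize c j ≡ 0 → ∀ v → c v ≢ j
    unused size≡0 v cv≡j = 1+n≰n (subst (0 <_) size≡0
      (filter-some (λ w → c w ≟ j) (Any.map (λ { refl → cv≡j }) (∈-allFin v))))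

  chromaticNumber-unique : ∀ {χ χ′} → IsChromaticNumber G χ → IsChromaticNumber G χ′ → χ ≡ χ′
  chromaticNumber-unique (colorable , minimal) (colorable′ , minimal′) =
    ≤-antisym (minimal _ colorable′) (minimal′ _ colorable)

  singletons≤stinginess : ∀ {χ ι} → IsChromaticNumber G χ → IsStinginess G ι →
    ∀ (c : Fin n → Fin χ) → Proper G χ c → singletons c ≤ ι
  singletons≤stinginess isχ (χ′ , isχ′ , _ , maximal) c proper
    with refl ← chromaticNumber-unique isχ isχ′ = maximal c proper

lemma3p2 : ∀ (n : ℕ) (G : Graph n) (χ ι : ℕ) → IsChromaticNumber G χ → IsStinginess G ι →
    2 * χ ≤ ι + n
lemma3p2 n G χ ι isχ@((c , proper) , minimal) isι = begin
  2 * χ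
    ≡⟨ cong (2 *_) (sym (length-tabulate {n = χ} (λ j → j))) ⟩
  2 * length (allFin χ)
    ≤⟨ 2*length≤sum+ones (classSize c) (classSize-pos G c proper minimal) (allFin χ) ⟩
  sum (map (classSize c) (allFin χ)) + singletons c
    ≡⟨ cong (_+ singletons c) (sum-classSize c) ⟩
  n + singletons c
    ≤⟨ +-monoʳ-≤ n (singletons≤stinginess G isχ isι c proper) ⟩
  n + ι
    ≡⟨ +-comm n ι ⟩
  ι + n ∎
  where open ≤-Reasoning
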